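{- The VC-density of the edge relation on the class $\mathcal{J}=\{J(m,k): m,k\in\mathbb{N}, k\le m\}$ of all Johnson graphs is $2$.
   Context: For $m\ge k$ and a set $X$ with $|X|=m$, the Johnson graph $J(m,k)$ has vertex set $\binom{X}{k}$, two vertices being adjacent iff their intersection has size $k-1$. For a graph $G$, the set system of the edge relation is $(V(G),\mathcal{S}_E)$ where $\mathcal{S}_E=\{N(v):v\in V(G)\}$ and $N(v)$ is the open neighbourhood of $v$. For a set system $(X,\mathcal{S})$ the shatter function is $\pi_{\mathcal{S}}(n)=\max\{|\{S\cap A: S\in\mathcal{S}\}| : A\subseteq X, |A|=n\}$; a set $A$ is shattered if $\{S\cap A:S\in\mathcal{S}\}=\mathcal{P}(A)$, and the VC-dimension is the supremum of sizes of shattered sets. For a class $\mathcal{C}$ of set systems, $\mathrm{VC}(\mathcal{C})$ is the supremum of the VC-dimensions of its members, $\pi_{\mathcal{C}}(n)=\max\{\pi_{\mathcal{S}}(n):(X,\mathcal{S})\in\mathcal{C}\}$, and the VC-density is $\mathrm{vc}(\mathcal{C})=\inf\{r\in\mathbb{R}^+:\pi_{\mathcal{C}}(n)\in\mathcal{O}(n^r)\}$ if $\mathrm{VC}(\mathcal{C})<\infty$, and $\infty$ otherwise. The VC-density of the edge relation on a class of graphs is the VC-density of the class of their edge-relation set systems. -}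

module Defs where

open import Data.Nat using (ℕ; zero; suc; _+_; _*_; _^_; _≤_; _<_; _≟_)
open import Data.Bool using (Bool; true; false)
import Data.Bool.Properties as BoolP
open import Data.Fin using (Fin)
open import Data.Fin.Subset using (Subset; _∩_; ∣_∣; inside; outside)
open import Data.Vec using (Vec; []; _∷_; tabulate)
open import Data.Vec.Properties using (≡-dec)
open import Data.List using (List; []; _∷_; map; filter; _++_; length; deduplicate)
open import Data.List.Membership.Propositional using (_∈_)
open import Data.Product using (Σ; _×_; _,_)
open import Relation.Nullary using (¬_; does)
open import Relation.Binary.PropositionalEquality using (_≡_)
open import Function.Definitions using (Injective)

allSubsets : (n : ℕ) → List (Subset n)
allSubsets zero = [] ∷ []
allSubsets (suc n) = map (inside ∷_) (allSubsets n) ++ map (outside ∷_) (allSubsets n)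

johnsonVertices : (m k : ℕ) → List (Subset m)
johnsonVertices m k = filter (λ s → ∣ s ∣ ≟ k) (allSubsets m)

-- Adjacency in J(m,k): |s ∩ t| = k - 1  (written as 1 + |s ∩ t| = k, so that
-- for k = 0 there are no edges, with no truncated subtraction).
adjᵇ : {m : ℕ} (k : ℕ) → Subset m → Subset m → Bool
adjᵇ k s t = does (suc ∣ s ∩ t ∣ ≟ k)

-- A set A of n vertices of J(m,k) is given by an injective enumeration a : Fin n → V.
-- The trace of the open neighbourhood N(v) on A, as a subset of (the index set of) A.
trace : {m n : ℕ} (k : ℕ) (a : Fin n → Subset m) → Subset m → Subset n
trace k a v = tabulate (λ i → adjᵇ k v (a i))

traces : (m k : ℕ) {n : ℕ} (a : Fin n → Subset m) → List (Subset n)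
traces m k a = map (trace k a) (johnsonVertices m k)

traceCount : (m k : ℕ) {n : ℕ} (a : Fin n → Subset m) → ℕ
traceCount m k a = length (deduplicate (≡-dec BoolP._≟_) (traces m k a))

IsVertexSet : (m k n : ℕ) → (Fin n → Subset m) → Set
IsVertexSet m k n a = ((i : Fin n) → ∣ a i ∣ ≡ k) × Injective _≡_ _≡_ a

Shattered : (m k n : ℕ) → (Fin n → Subset m) → Set
Shattered m k n a = (t : Subset n) → t ∈ traces m k a

FiniteVC : Set
FiniteVC = Σ ℕ λ d → (m k n : ℕ) → k ≤ m → (a : Fin n → Subset m) →
  IsVertexSet m k n a → Shattered m k n a → n ≤ d

-- π_𝒥(n) ∈ O(n^(p/q))  (q > 0), i.e. ∃ C N. ∀ n ≥ N. π_𝒥(n)^q ≤ C · n^p,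
-- where π_𝒥(n) ≤ X is unfolded as: every trace count on every n-set A of every
-- J(m,k) (k ≤ m) is ≤ X.
ShatterFnBigO : (p q : ℕ) → Set
ShatterFnBigO p q = Σ ℕ λ C → Σ ℕ λ N → (n : ℕ) → N ≤ n →
  (m k : ℕ) → k ≤ m → (a : Fin n → Subset m) → IsVertexSet m k n a →
  traceCount m k a ^ q ≤ C * n ^ p

-- vc(𝒥) = 2 : VC(𝒥) finite and inf { r > 0 : π_𝒥 ∈ O(n^r) } = 2.
-- Since this set of exponents is upward closed, the infimum equals 2 iff every
-- positive rational r = p/q > 2 lies in it and no positive rational r < 2 does.
VCDensityIsTwo : Set
VCDensityIsTwo = FiniteVC ×
  (((p q : ℕ) → 0 < q → 2 * q < p → ShatterFnBigO p q) ×
   ((p q : ℕ) → 0 < q → 0 < p → p < 2 * q → ¬ ShatterFnBigO p q))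

module Submission where

-- Let A = {a l} be n vertices of J(m,k) and v a vertex.  Every neighbour a l of v arises from v by
-- removing one element x l and adding one element y l.  If two neighbours of v in A differ in both
-- x and y, then v is one of the four common neighbours of those two members of A.  Otherwise any
-- two neighbours share x or share y, hence (as they are distinct) all share one x or all share
-- one y; the trace is then {l : v - x ⊆ a l, a l ≠ v} or {l : a l ⊆ v ∪ {y}, a l ≠ v}, and
-- v - x = a i ∩ a j, v ∪ {y} = a i ∪ a j for two members a i, a j of A (or for a i = v and one
-- more member).  So every trace on A is one of at most 1 + 9n² explicit sets: π(n) = O(n²) and no
-- set of size 10 is shattered.  Conversely, with a l = {L l, R l} in J(4h,2), the vertices
-- {L p, L q} cut out the h² distinct traces {p, q}, so π(n) is not O(n^r) for r < 2.

open import Defs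
open import Data.Nat using (ℕ; zero; suc; pred; _+_; _*_; _^_; _≤_; _<_; _≤?_; z≤n; s≤s)
import Data.Nat as ℕ
open import Data.Nat.Properties
  using (suc-injective; 1+n≢n; ≡-irrelevant; +-suc; +-comm; +-identityʳ; +-cancelˡ-≡; *-assoc; ^-distribˡ-+-*;
         m^n≢0; ≤-reflexive; ≤-trans; <⇒≤; <⇒≱; ≰⇒>; n≤1+n; m≤m+n; m≤n+m; m<m+n; n≤1⇒n≡0∨n≡1;
         m≤n⇒∃[o]m+o≡n; +-mono-≤; *-monoʳ-≤; *-cancelʳ-≤; ^-monoˡ-≤; ^-monoʳ-≤; module ≤-Reasoning)
open import Data.Nat.Tactic.RingSolver using (solve-∀)
open import Data.Bool using (Bool; true; false)
import Data.Bool.Properties as Bool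
open import Data.Fin using (Fin; zero; suc; _≟_; _↑ˡ_; _↑ʳ_)
import Data.Fin.Properties as Fin
open import Data.Fin.Subset
  using (Subset; ⊥; ⁅_⁆; _∩_; _∪_; _─_; _-_; ∣_∣; _∈_; _∉_; _⊆_; inside; outside)
open import Data.Fin.Subset.Properties
  using (_∈?_; _⊆?_; x∈⁅x⁆; x∈⁅y⁆⇒x≡y; x∉⁅y⁆⇒x≢y; x∈p∩q⁺; x∈p∩q⁻; x∈p∪q⁺; x∈p∪q⁻; ∩-comm; ∩-idem;
         x∈p∧x∉q⇒x∈p─q; p─q⊆p; x∈p∧x≢y⇒x∈p-y; p─⊥≡p; ⊆-antisym; p⊆q⇒∣p∣≤∣q∣; Empty-unique;
         ∉⊥; ∣⊥∣≡0; ∣⁅x⁆∣≡1)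
open import Data.Vec using (_∷_; []; tabulate)
import Data.Vec as Vec
open import Data.Vec.Properties using (tabulate-cong; lookup∘tabulate; []=⇒lookup; lookup⇒[]=; ∷-injectiveʳ; ≡-dec)
open import Data.List
  using (List; []; _∷_; length; map; _++_; allFin; cartesianProduct; cartesianProductWith; deduplicate)
open import Data.List.Properties using (length-++; length-map; length-tabulate)
import Data.List.Membership.Propositional as List
open import Data.List.Membership.Propositional.Properties
  using (∈-map⁺; ∈-map⁻; ∈-++⁺ˡ; ∈-++⁺ʳ; ∈-filter⁺; ∈-filter⁻; ∈-allFin; ∈-deduplicate⁺; ∈-deduplicate⁻;
         ∈-cartesianProduct⁺; ∈-cartesianProductWith⁺; ∈-cartesianProductWith⁻)
import Data.List.Relation.Binary.Subset.Propositional as List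
open import Data.List.Relation.Binary.Disjoint.Propositional using (Disjoint)
open import Data.List.Relation.Unary.Any using (here; there)
import Data.List.Relation.Unary.All as All
open import Data.List.Relation.Unary.AllPairs using ([]; _∷_)
open import Data.List.Relation.Unary.Unique.Propositional using (Unique)
open import Data.List.Relation.Unary.Unique.Propositional.Properties using (++⁺; map⁺; cartesianProductWith⁺; allFin⁺)
open import Data.List.Relation.Unary.Unique.DecPropositional.Properties using (deduplicate-!)
open import Data.Product using (Σ; ∃; ∃₂; _×_; _,_; proj₁; proj₂)
open import Data.Sum using (_⊎_; inj₁; inj₂; swap)
import Data.Sum as Sum
open import Data.Unit using (tt)
open import Function using (_∘_)
open import Function.Bundles using (_⇔_; mk⇔; module Equivalence)
open import Relation.Nullary using (Dec; yes; no; does; ¬_; contradiction; ¬?; _×-dec_)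
open import Relation.Nullary.Decidable using (map′; does-⇔; dec-true; toWitness)
import Relation.Nullary.Irrelevant as Nullary
open import Relation.Unary using (Decidable)
open import Relation.Binary.Definitions using (DecidableEquality)
open import Relation.Binary.PropositionalEquality
  using (_≡_; _≢_; refl; sym; trans; cong; cong₂; subst; module ≡-Reasoning)

private
  variable
    m n : ℕ

module _ {A : Set} where

  private
    remove : ∀ {x} {ys : List A} → x List.∈ ys →
      Σ (List A) λ zs → length ys ≡ suc (length zs) × (∀ {z} → z List.∈ ys → z ≢ x → z List.∈ zs)
    remove {ys = y ∷ ys} (here refl) =
      ys , refl , λ { (here z≡x) z≢x → contradiction z≡x z≢x ; (there z∈ys) _ → z∈ys }
    remove {ys = y ∷ ys} (there x∈ys) with zs , eq , keep ← remove x∈ys =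
      y ∷ zs , cong suc eq , λ { (here z≡y) _ → here z≡y ; (there z∈ys) z≢x → there (keep z∈ys z≢x) }

  Unique-⊆⇒length≤ : ∀ {xs ys : List A} → Unique xs → xs List.⊆ ys → length xs ≤ length ys
  Unique-⊆⇒length≤ {[]} _ _ = z≤n
  Unique-⊆⇒length≤ {x ∷ xs} (x∉xs ∷ xs!) xs⊆ys with zs , eq , keep ← remove (xs⊆ys (here refl)) =
    subst (suc (length xs) ≤_) (sym eq)
      (s≤s (Unique-⊆⇒length≤ xs! λ z∈xs → keep (xs⊆ys (there z∈xs)) λ z≡x → All.lookup x∉xs z∈xs (sym z≡x)))

  module _ (_≟ᴬ_ : DecidableEquality A) where

    length-deduplicate-≤ : ∀ {xs ys : List A} → xs List.⊆ ys → length (deduplicate _≟ᴬ_ xs) ≤ length ys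
    length-deduplicate-≤ {xs} xs⊆ys = Unique-⊆⇒length≤ (deduplicate-! _≟ᴬ_ xs) (xs⊆ys ∘ ∈-deduplicate⁻ _≟ᴬ_ xs)

    length-deduplicate-≥ : ∀ {xs ys : List A} → Unique ys → ys List.⊆ xs → length ys ≤ length (deduplicate _≟ᴬ_ xs)
    length-deduplicate-≥ ys! ys⊆xs = Unique-⊆⇒length≤ ys! (∈-deduplicate⁺ _≟ᴬ_ ∘ ys⊆xs)

length-cartesianProductWith : ∀ {A B C : Set} (f : A → B → C) xs ys →
  length (cartesianProductWith f xs ys) ≡ length xs * length ys
length-cartesianProductWith f [] ys = refl
length-cartesianProductWith f (x ∷ xs) ys = trans (length-++ (map (f x) ys))
  (cong₂ _+_ (length-map (f x) ys) (length-cartesianProductWith f xs ys))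

-- Finite subsets

subsetOf : {P : Fin n → Set} → Decidable P → Subset n
subsetOf P? = tabulate λ i → does (P? i)

subsetOf-cong : {P Q : Fin n → Set} (P? : Decidable P) (Q? : Decidable Q) →
  (∀ i → P i ⇔ Q i) → subsetOf P? ≡ subsetOf Q?
subsetOf-cong P? Q? P⇔Q = tabulate-cong λ i → does-⇔ (P⇔Q i) (P? i) (Q? i)

∈-subsetOf⁺ : {P : Fin n → Set} (P? : Decidable P) {i : Fin n} → P i → i ∈ subsetOf P?
∈-subsetOf⁺ P? {i} Pi = lookup⇒[]= i (subsetOf P?) (trans (lookup∘tabulate _ i) (dec-true (P? i) Pi))

∈-subsetOf⁻ : {P : Fin n → Set} (P? : Decidable P) {i : Fin n} → i ∈ subsetOf P? → P i
∈-subsetOf⁻ P? {i} i∈P with P? i | trans (sym (lookup∘tabulate (λ j → does (P? j)) i)) ([]=⇒lookup i∈P)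
... | yes Pi | _ = Pi
... | no _ | ()

subsetOf≡ : {P : Fin n → Set} (P? : Decidable P) {p : Subset n} → (∀ i → P i ⇔ i ∈ p) → subsetOf P? ≡ p
subsetOf≡ P? P⇔∈p = ⊆-antisym (λ i∈P → Equivalence.to (P⇔∈p _) (∈-subsetOf⁻ P? i∈P))
                              (λ i∈p → ∈-subsetOf⁺ P? (Equivalence.from (P⇔∈p _) i∈p))

x∈⁅y⁆∪⁅z⁆⁺ : {x y z : Fin n} → x ≡ y ⊎ x ≡ z → x ∈ ⁅ y ⁆ ∪ ⁅ z ⁆
x∈⁅y⁆∪⁅z⁆⁺ (inj₁ refl) = x∈p∪q⁺ (inj₁ (x∈⁅x⁆ _))
x∈⁅y⁆∪⁅z⁆⁺ (inj₂ refl) = x∈p∪q⁺ (inj₂ (x∈⁅x⁆ _))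

x∈⁅y⁆∪⁅z⁆⁻ : {x y z : Fin n} → x ∈ ⁅ y ⁆ ∪ ⁅ z ⁆ → x ≡ y ⊎ x ≡ z
x∈⁅y⁆∪⁅z⁆⁻ {y = y} {z} x∈y∪z = Sum.map (x∈⁅y⁆⇒x≡y y) (x∈⁅y⁆⇒x≡y z) (x∈p∪q⁻ ⁅ y ⁆ ⁅ z ⁆ x∈y∪z)

x∈p─q⇒x∉q : ∀ (p q : Subset m) {x} → x ∈ p ─ q → x ∉ q
x∈p─q⇒x∉q (inside ∷ p) (outside ∷ q) Vec.here ()
x∈p─q⇒x∉q (_ ∷ p) (_ ∷ q) (Vec.there x∈p─q) (Vec.there x∈q) = x∈p─q⇒x∉q p q x∈p─q x∈q

x∈p-y⇒x≢y : ∀ (p : Subset m) {x y} → x ∈ p - y → x ≢ y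
x∈p-y⇒x≢y p {y = y} x∈p-y = x∉⁅y⁆⇒x≢y (x∈p─q⇒x∉q p ⁅ y ⁆ x∈p-y)

∣p∣≡∣p∩q∣+∣p─q∣ : ∀ (p q : Subset n) → ∣ p ∣ ≡ ∣ p ∩ q ∣ + ∣ p ─ q ∣
∣p∣≡∣p∩q∣+∣p─q∣ [] [] = refl
∣p∣≡∣p∩q∣+∣p─q∣ (inside ∷ p) (inside ∷ q) = cong suc (∣p∣≡∣p∩q∣+∣p─q∣ p q)
∣p∣≡∣p∩q∣+∣p─q∣ (inside ∷ p) (outside ∷ q) = trans (cong suc (∣p∣≡∣p∩q∣+∣p─q∣ p q)) (sym (+-suc _ _))
∣p∣≡∣p∩q∣+∣p─q∣ (outside ∷ p) (inside ∷ q) = ∣p∣≡∣p∩q∣+∣p─q∣ p q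
∣p∣≡∣p∩q∣+∣p─q∣ (outside ∷ p) (outside ∷ q) = ∣p∣≡∣p∩q∣+∣p─q∣ p q

∣p∪q∣+∣p∩q∣≡∣p∣+∣q∣ : ∀ (p q : Subset n) → ∣ p ∪ q ∣ + ∣ p ∩ q ∣ ≡ ∣ p ∣ + ∣ q ∣
∣p∪q∣+∣p∩q∣≡∣p∣+∣q∣ [] [] = refl
∣p∪q∣+∣p∩q∣≡∣p∣+∣q∣ (inside ∷ p) (inside ∷ q) =
  cong suc (trans (+-suc _ _) (trans (cong suc (∣p∪q∣+∣p∩q∣≡∣p∣+∣q∣ p q)) (sym (+-suc _ _))))
∣p∪q∣+∣p∩q∣≡∣p∣+∣q∣ (inside ∷ p) (outside ∷ q) = cong suc (∣p∪q∣+∣p∩q∣≡∣p∣+∣q∣ p q)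
∣p∪q∣+∣p∩q∣≡∣p∣+∣q∣ (outside ∷ p) (inside ∷ q) = trans (cong suc (∣p∪q∣+∣p∩q∣≡∣p∣+∣q∣ p q)) (sym (+-suc _ _))
∣p∪q∣+∣p∩q∣≡∣p∣+∣q∣ (outside ∷ p) (outside ∷ q) = ∣p∪q∣+∣p∩q∣≡∣p∣+∣q∣ p q

∣p∣≡0⇒p≡⊥ : ∀ {p : Subset n} → ∣ p ∣ ≡ 0 → p ≡ ⊥
∣p∣≡0⇒p≡⊥ {p = []} _ = refl
∣p∣≡0⇒p≡⊥ {p = outside ∷ p} ∣p∣≡0 = cong (outside ∷_) (∣p∣≡0⇒p≡⊥ ∣p∣≡0)

∣p∣≡1⇒p≡⁅x⁆ : ∀ {p : Subset n} → ∣ p ∣ ≡ 1 → ∃ λ x → p ≡ ⁅ x ⁆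
∣p∣≡1⇒p≡⁅x⁆ {p = inside ∷ p} ∣p∣≡1 = zero , cong (inside ∷_) (∣p∣≡0⇒p≡⊥ (suc-injective ∣p∣≡1))
∣p∣≡1⇒p≡⁅x⁆ {p = outside ∷ p} ∣p∣≡1 with x , p≡⁅x⁆ ← ∣p∣≡1⇒p≡⁅x⁆ ∣p∣≡1 = suc x , cong (outside ∷_) p≡⁅x⁆

x≢y⇒∣⁅x⁆∪⁅y⁆∣≡2 : {x y : Fin n} → x ≢ y → ∣ ⁅ x ⁆ ∪ ⁅ y ⁆ ∣ ≡ 2
x≢y⇒∣⁅x⁆∪⁅y⁆∣≡2 {n} {x} {y} x≢y = begin
  ∣ ⁅ x ⁆ ∪ ⁅ y ⁆ ∣                    ≡⟨ +-identityʳ _ ⟨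
  ∣ ⁅ x ⁆ ∪ ⁅ y ⁆ ∣ + 0                ≡⟨ cong (∣ ⁅ x ⁆ ∪ ⁅ y ⁆ ∣ +_) (∣⊥∣≡0 n) ⟨
  ∣ ⁅ x ⁆ ∪ ⁅ y ⁆ ∣ + ∣ ⊥ {n} ∣          ≡⟨ cong (λ r → ∣ ⁅ x ⁆ ∪ ⁅ y ⁆ ∣ + ∣ r ∣) disjoint ⟨
  ∣ ⁅ x ⁆ ∪ ⁅ y ⁆ ∣ + ∣ ⁅ x ⁆ ∩ ⁅ y ⁆ ∣ ≡⟨ ∣p∪q∣+∣p∩q∣≡∣p∣+∣q∣ ⁅ x ⁆ ⁅ y ⁆ ⟩
  ∣ ⁅ x ⁆ ∣ + ∣ ⁅ y ⁆ ∣                 ≡⟨ cong₂ _+_ (∣⁅x⁆∣≡1 x) (∣⁅x⁆∣≡1 y) ⟩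
  2                                   ∎
  where
  open ≡-Reasoning
  disjoint : ⁅ x ⁆ ∩ ⁅ y ⁆ ≡ ⊥
  disjoint = Empty-unique λ (z , z∈x∩y) → let z∈x , z∈y = x∈p∩q⁻ ⁅ x ⁆ ⁅ y ⁆ z∈x∩y in
    x≢y (trans (sym (x∈⁅y⁆⇒x≡y x z∈x)) (x∈⁅y⁆⇒x≡y y z∈y))

∣p∣≡1⇔x∈p : {p : Subset n} {x : Fin n} → p ⊆ ⁅ x ⁆ → (∣ p ∣ ≡ 1) ⇔ (x ∈ p)
∣p∣≡1⇔x∈p {p = p} {x} p⊆⁅x⁆ = mk⇔ to from
  where
  to : ∣ p ∣ ≡ 1 → x ∈ p
  to ∣p∣≡1 with y , refl ← ∣p∣≡1⇒p≡⁅x⁆ {p = p} ∣p∣≡1 = subst (_∈ ⁅ y ⁆) (x∈⁅y⁆⇒x≡y x (p⊆⁅x⁆ (x∈⁅x⁆ y))) (x∈⁅x⁆ y)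
  from : x ∈ p → ∣ p ∣ ≡ 1
  from x∈p = trans (cong ∣_∣ (⊆-antisym p⊆⁅x⁆ λ e∈⁅x⁆ → subst (_∈ p) (sym (x∈⁅y⁆⇒x≡y x e∈⁅x⁆)) x∈p)) (∣⁅x⁆∣≡1 x)

∣p─q∣≡0⇒p⊆q : ∀ {p q : Subset m} → ∣ p ─ q ∣ ≡ 0 → p ⊆ q
∣p─q∣≡0⇒p⊆q {p = p} {q} ∣p─q∣≡0 {x} x∈p with x ∈? q
... | yes x∈q = x∈q
... | no x∉q = contradiction (subst (x ∈_) (∣p∣≡0⇒p≡⊥ ∣p─q∣≡0) (x∈p∧x∉q⇒x∈p─q x∈p x∉q)) ∉⊥

p⊆⁅x⁆⇒∣p∣≤1 : ∀ {p : Subset m} {x} → p ⊆ ⁅ x ⁆ → ∣ p ∣ ≤ 1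
p⊆⁅x⁆⇒∣p∣≤1 {x = x} p⊆⁅x⁆ = ≤-trans (p⊆q⇒∣p∣≤∣q∣ p⊆⁅x⁆) (≤-reflexive (∣⁅x⁆∣≡1 x))

least : Subset m → Subset m
least [] = []
least (inside ∷ p) = inside ∷ ⊥
least (outside ∷ p) = outside ∷ least p

pick : Bool → Subset m → Subset m
pick true p = least p
pick false p = p ─ least p

pick-∷-outside : ∀ b (p : Subset m) → pick b (outside ∷ p) ≡ outside ∷ pick b p
pick-∷-outside true p = refl
pick-∷-outside false p = refl

∣p∣≡2⇒pick≡⁅x⁆ : ∀ {p : Subset m} {x} → ∣ p ∣ ≡ 2 → x ∈ p → ∃ λ b → pick b p ≡ ⁅ x ⁆
∣p∣≡2⇒pick≡⁅x⁆ {p = inside ∷ p} _ Vec.here = true , refl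
∣p∣≡2⇒pick≡⁅x⁆ {p = inside ∷ p} ∣p∣≡2 (Vec.there x∈p) with y , p≡⁅y⁆ ← ∣p∣≡1⇒p≡⁅x⁆ {p = p} (cong pred ∣p∣≡2) =
  false , cong (outside ∷_) (trans (p─⊥≡p p) (trans p≡⁅y⁆ (cong ⁅_⁆ (sym (x∈⁅y⁆⇒x≡y y (subst (_ ∈_) p≡⁅y⁆ x∈p))))))
∣p∣≡2⇒pick≡⁅x⁆ {p = outside ∷ p} ∣p∣≡2 (Vec.there x∈p) with b , pick≡⁅x⁆ ← ∣p∣≡2⇒pick≡⁅x⁆ ∣p∣≡2 x∈p =
  b , trans (pick-∷-outside b p) (cong (outside ∷_) pick≡⁅x⁆)

∈-allSubsets : ∀ (p : Subset n) → p List.∈ allSubsets n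
∈-allSubsets [] = here refl
∈-allSubsets (inside ∷ p) = ∈-++⁺ˡ (∈-map⁺ (inside ∷_) (∈-allSubsets p))
∈-allSubsets {suc n} (outside ∷ p) = ∈-++⁺ʳ (map (inside ∷_) (allSubsets n)) (∈-map⁺ (outside ∷_) (∈-allSubsets p))

length-allSubsets : ∀ n → length (allSubsets n) ≡ 2 ^ n
length-allSubsets zero = refl
length-allSubsets (suc n) = begin
  length (map (inside ∷_) (allSubsets n) ++ map (outside ∷_) (allSubsets n))
    ≡⟨ length-++ (map (inside ∷_) (allSubsets n)) ⟩
  length (map (inside ∷_) (allSubsets n)) + length (map (outside ∷_) (allSubsets n))
    ≡⟨ cong₂ _+_ (length-map (inside ∷_) (allSubsets n)) (length-map (outside ∷_) (allSubsets n)) ⟩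
  length (allSubsets n) + length (allSubsets n)
    ≡⟨ cong (λ l → l + l) (length-allSubsets n) ⟩
  2 ^ n + 2 ^ n
    ≡⟨ cong (2 ^ n +_) (+-identityʳ (2 ^ n)) ⟨
  2 ^ suc n ∎
  where open ≡-Reasoning

allSubsets-unique : ∀ n → Unique (allSubsets n)
allSubsets-unique zero = All.[] ∷ []
allSubsets-unique (suc n) =
  ++⁺ (map⁺ ∷-injectiveʳ (allSubsets-unique n)) (map⁺ ∷-injectiveʳ (allSubsets-unique n)) disjoint
  where
  disjoint : Disjoint (map (inside ∷_) (allSubsets n)) (map (outside ∷_) (allSubsets n))
  disjoint (p∈ins , p∈outs) with _ , _ , refl ← ∈-map⁻ (inside ∷_) p∈ins | _ , _ , () ← ∈-map⁻ (outside ∷_) p∈outs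

-- Adjacency in Johnson graphs

Adjacent : ℕ → Subset m → Subset m → Set
Adjacent k v w = suc ∣ v ∩ w ∣ ≡ k

Adjacent⇒≢ : ∀ {k} {v w : Subset m} → ∣ v ∣ ≡ k → Adjacent k v w → w ≢ v
Adjacent⇒≢ {v = v} ∣v∣≡k v~v refl = 1+n≢n (trans (cong (suc ∘ ∣_∣) (sym (∩-idem v))) (trans v~v (sym ∣v∣≡k)))

record Swap (v w : Subset m) : Set where
  field
    removed added : Fin m
    v─w≡⁅removed⁆ : v ─ w ≡ ⁅ removed ⁆
    w─v≡⁅added⁆ : w ─ v ≡ ⁅ added ⁆

  removed∈v : removed ∈ v
  removed∈v = p─q⊆p v w (subst (removed ∈_) (sym v─w≡⁅removed⁆) (x∈⁅x⁆ removed))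

  removed∉w : removed ∉ w
  removed∉w = x∈p─q⇒x∉q v w (subst (removed ∈_) (sym v─w≡⁅removed⁆) (x∈⁅x⁆ removed))

  added∈w : added ∈ w
  added∈w = p─q⊆p w v (subst (added ∈_) (sym w─v≡⁅added⁆) (x∈⁅x⁆ added))

  added∉v : added ∉ v
  added∉v = x∈p─q⇒x∉q w v (subst (added ∈_) (sym w─v≡⁅added⁆) (x∈⁅x⁆ added))

  only-removed : ∀ {x} → x ∈ v → x ∉ w → x ≡ removed
  only-removed {x} x∈v x∉w = x∈⁅y⁆⇒x≡y removed (subst (x ∈_) v─w≡⁅removed⁆ (x∈p∧x∉q⇒x∈p─q x∈v x∉w))

  only-added : ∀ {x} → x ∈ w → x ∉ v → x ≡ added
  only-added {x} x∈w x∉v = x∈⁅y⁆⇒x≡y added (subst (x ∈_) w─v≡⁅added⁆ (x∈p∧x∉q⇒x∈p─q x∈w x∉v))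

  ∈v⇒∈w : ∀ {x} → x ∈ v → x ≢ removed → x ∈ w
  ∈v⇒∈w {x} x∈v x≢removed with x ∈? w
  ... | yes x∈w = x∈w
  ... | no x∉w = contradiction (only-removed x∈v x∉w) x≢removed

  ∈w⇒∈v : ∀ {x} → x ∈ w → x ≢ added → x ∈ v
  ∈w⇒∈v {x} x∈w x≢added with x ∈? v
  ... | yes x∈v = x∈v
  ... | no x∉v = contradiction (only-added x∈w x∉v) x≢added

  v-removed⊆w : v - removed ⊆ w
  v-removed⊆w x∈v-removed = ∈v⇒∈w (p─q⊆p v _ x∈v-removed) (x∈p-y⇒x≢y v x∈v-removed)

  w⊆v∪⁅added⁆ : w ⊆ v ∪ ⁅ added ⁆
  w⊆v∪⁅added⁆ {x} x∈w with x ≟ added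
  ... | yes refl = x∈p∪q⁺ (inj₂ (x∈⁅x⁆ added))
  ... | no x≢added = x∈p∪q⁺ (inj₁ (∈w⇒∈v x∈w x≢added))

module _ {k} {v w : Subset m} (∣v∣≡k : ∣ v ∣ ≡ k) (∣w∣≡k : ∣ w ∣ ≡ k) where
  open ≡-Reasoning

  ∣v─w∣≡∣w─v∣ : ∣ v ─ w ∣ ≡ ∣ w ─ v ∣
  ∣v─w∣≡∣w─v∣ = +-cancelˡ-≡ ∣ v ∩ w ∣ _ _ (begin
    ∣ v ∩ w ∣ + ∣ v ─ w ∣ ≡⟨ ∣p∣≡∣p∩q∣+∣p─q∣ v w ⟨
    ∣ v ∣                 ≡⟨ trans ∣v∣≡k (sym ∣w∣≡k) ⟩
    ∣ w ∣                 ≡⟨ ∣p∣≡∣p∩q∣+∣p─q∣ w v ⟩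
    ∣ w ∩ v ∣ + ∣ w ─ v ∣ ≡⟨ cong (λ u → ∣ u ∣ + ∣ w ─ v ∣) (∩-comm w v) ⟩
    ∣ v ∩ w ∣ + ∣ w ─ v ∣ ∎)

  Adjacent⇒∣v─w∣≡1 : Adjacent k v w → ∣ v ─ w ∣ ≡ 1
  Adjacent⇒∣v─w∣≡1 v~w = +-cancelˡ-≡ ∣ v ∩ w ∣ _ _ (begin
    ∣ v ∩ w ∣ + ∣ v ─ w ∣ ≡⟨ ∣p∣≡∣p∩q∣+∣p─q∣ v w ⟨
    ∣ v ∣                 ≡⟨ trans ∣v∣≡k (sym v~w) ⟩
    suc ∣ v ∩ w ∣         ≡⟨ +-comm 1 _ ⟩
    ∣ v ∩ w ∣ + 1         ∎)

  ∣v─w∣≡1⇒Adjacent : ∣ v ─ w ∣ ≡ 1 → Adjacent k v w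
  ∣v─w∣≡1⇒Adjacent ∣v─w∣≡1 = begin
    suc ∣ v ∩ w ∣         ≡⟨ +-comm 1 _ ⟩
    ∣ v ∩ w ∣ + 1         ≡⟨ cong (∣ v ∩ w ∣ +_) ∣v─w∣≡1 ⟨
    ∣ v ∩ w ∣ + ∣ v ─ w ∣ ≡⟨ ∣p∣≡∣p∩q∣+∣p─q∣ v w ⟨
    ∣ v ∣                 ≡⟨ ∣v∣≡k ⟩
    k                     ∎

  Adjacent⇒Swap : Adjacent k v w → Swap v w
  Adjacent⇒Swap v~w
    with x , v─w≡⁅x⁆ ← ∣p∣≡1⇒p≡⁅x⁆ (Adjacent⇒∣v─w∣≡1 v~w)
       | y , w─v≡⁅y⁆ ← ∣p∣≡1⇒p≡⁅x⁆ (trans (sym ∣v─w∣≡∣w─v∣) (Adjacent⇒∣v─w∣≡1 v~w))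
    = record { removed = x ; added = y ; v─w≡⁅removed⁆ = v─w≡⁅x⁆ ; w─v≡⁅added⁆ = w─v≡⁅y⁆ }

  ∣v─w∣≤1⇒Adjacent : ∣ v ─ w ∣ ≤ 1 → w ≢ v → Adjacent k v w
  ∣v─w∣≤1⇒Adjacent ∣v─w∣≤1 w≢v with n≤1⇒n≡0∨n≡1 ∣v─w∣≤1
  ... | inj₂ ∣v─w∣≡1 = ∣v─w∣≡1⇒Adjacent ∣v─w∣≡1
  ... | inj₁ ∣v─w∣≡0 = contradiction
    (⊆-antisym (∣p─q∣≡0⇒p⊆q (trans (sym ∣v─w∣≡∣w─v∣) ∣v─w∣≡0)) (∣p─q∣≡0⇒p⊆q ∣v─w∣≡0)) w≢v

  v-x⊆w⇒Adjacent : ∀ x → v - x ⊆ w → w ≢ v → Adjacent k v w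
  v-x⊆w⇒Adjacent x v-x⊆w = ∣v─w∣≤1⇒Adjacent (p⊆⁅x⁆⇒∣p∣≤1 v─w⊆⁅x⁆)
    where
    v─w⊆⁅x⁆ : v ─ w ⊆ ⁅ x ⁆
    v─w⊆⁅x⁆ {e} e∈v─w with e ≟ x
    ... | yes refl = x∈⁅x⁆ x
    ... | no e≢x = contradiction (v-x⊆w (x∈p∧x≢y⇒x∈p-y (p─q⊆p v w e∈v─w) e≢x)) (x∈p─q⇒x∉q v w e∈v─w)

  w⊆v∪⁅y⁆⇒Adjacent : ∀ y → w ⊆ v ∪ ⁅ y ⁆ → w ≢ v → Adjacent k v w
  w⊆v∪⁅y⁆⇒Adjacent y w⊆v∪⁅y⁆ = ∣v─w∣≤1⇒Adjacent (subst (_≤ 1) (sym ∣v─w∣≡∣w─v∣) (p⊆⁅x⁆⇒∣p∣≤1 w─v⊆⁅y⁆))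
    where
    w─v⊆⁅y⁆ : w ─ v ⊆ ⁅ y ⁆
    w─v⊆⁅y⁆ e∈w─v with x∈p∪q⁻ v ⁅ y ⁆ (w⊆v∪⁅y⁆ (p─q⊆p w v e∈w─v))
    ... | inj₁ e∈v = contradiction e∈v (x∈p─q⇒x∉q w v e∈w─v)
    ... | inj₂ e∈⁅y⁆ = e∈⁅y⁆

module _ {v w : Subset m} (σ : Swap v w) where
  open Swap σ

  v∩w≡v-removed : v ∩ w ≡ v - removed
  v∩w≡v-removed = ⊆-antisym lhs⊆rhs rhs⊆lhs
    where
    lhs⊆rhs : v ∩ w ⊆ v - removed
    lhs⊆rhs x∈v∩w with x∈v , x∈w ← x∈p∩q⁻ v w x∈v∩w = x∈p∧x≢y⇒x∈p-y x∈v λ { refl → removed∉w x∈w }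
    rhs⊆lhs : v - removed ⊆ v ∩ w
    rhs⊆lhs x∈v-removed = x∈p∩q⁺ (p─q⊆p v _ x∈v-removed , v-removed⊆w x∈v-removed)

  v∪w≡v∪⁅added⁆ : v ∪ w ≡ v ∪ ⁅ added ⁆
  v∪w≡v∪⁅added⁆ = ⊆-antisym lhs⊆rhs rhs⊆lhs
    where
    lhs⊆rhs : v ∪ w ⊆ v ∪ ⁅ added ⁆
    lhs⊆rhs x∈v∪w with x∈p∪q⁻ v w x∈v∪w
    ... | inj₁ x∈v = x∈p∪q⁺ (inj₁ x∈v)
    ... | inj₂ x∈w = w⊆v∪⁅added⁆ x∈w
    rhs⊆lhs : v ∪ ⁅ added ⁆ ⊆ v ∪ w
    rhs⊆lhs x∈v∪y with x∈p∪q⁻ v ⁅ added ⁆ x∈v∪y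
    ... | inj₁ x∈v = x∈p∪q⁺ (inj₁ x∈v)
    ... | inj₂ x∈⁅y⁆ = x∈p∪q⁺ (inj₂ (subst (_∈ w) (sym (x∈⁅y⁆⇒x≡y added x∈⁅y⁆)) added∈w))

module _ {v w₁ w₂ : Subset m} (σ₁ : Swap v w₁) (σ₂ : Swap v w₂) where
  private
    module σ₁ = Swap σ₁
    module σ₂ = Swap σ₂

  same-swap⇒⊆ : σ₁.removed ≡ σ₂.removed → σ₁.added ≡ σ₂.added → w₁ ⊆ w₂
  same-swap⇒⊆ x₁≡x₂ y₁≡y₂ {x} x∈w₁ with x ∈? v
  ... | yes x∈v = σ₂.∈v⇒∈w x∈v λ x≡x₂ → σ₁.removed∉w (subst (_∈ w₁) (trans x≡x₂ (sym x₁≡x₂)) x∈w₁)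
  ... | no x∉v = subst (_∈ w₂) (sym (trans (σ₁.only-added x∈w₁ x∉v) y₁≡y₂)) σ₂.added∈w

  w₁∩w₂≡v-removed : σ₁.removed ≡ σ₂.removed → σ₁.added ≢ σ₂.added → w₁ ∩ w₂ ≡ v - σ₁.removed
  w₁∩w₂≡v-removed x₁≡x₂ y₁≢y₂ = ⊆-antisym lhs⊆rhs rhs⊆lhs
    where
    lhs⊆rhs : w₁ ∩ w₂ ⊆ v - σ₁.removed
    lhs⊆rhs {x} x∈w₁∩w₂ with x∈w₁ , x∈w₂ ← x∈p∩q⁻ w₁ w₂ x∈w₁∩w₂ | x ∈? v
    ... | yes x∈v = x∈p∧x≢y⇒x∈p-y x∈v λ { refl → σ₁.removed∉w x∈w₁ }
    ... | no x∉v = contradiction (trans (sym (σ₁.only-added x∈w₁ x∉v)) (σ₂.only-added x∈w₂ x∉v)) y₁≢y₂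
    rhs⊆lhs : v - σ₁.removed ⊆ w₁ ∩ w₂
    rhs⊆lhs x∈v-x₁ = x∈p∩q⁺ (σ₁.v-removed⊆w x∈v-x₁ , σ₂.v-removed⊆w (subst (λ x₁ → _ ∈ v - x₁) x₁≡x₂ x∈v-x₁))

  w₁∪w₂≡v∪⁅added⁆ : σ₁.added ≡ σ₂.added → σ₁.removed ≢ σ₂.removed → w₁ ∪ w₂ ≡ v ∪ ⁅ σ₁.added ⁆
  w₁∪w₂≡v∪⁅added⁆ y₁≡y₂ x₁≢x₂ = ⊆-antisym lhs⊆rhs rhs⊆lhs
    where
    lhs⊆rhs : w₁ ∪ w₂ ⊆ v ∪ ⁅ σ₁.added ⁆
    lhs⊆rhs x∈w₁∪w₂ with x∈p∪q⁻ w₁ w₂ x∈w₁∪w₂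
    ... | inj₁ x∈w₁ = σ₁.w⊆v∪⁅added⁆ x∈w₁
    ... | inj₂ x∈w₂ = subst (λ y → _ ∈ v ∪ ⁅ y ⁆) (sym y₁≡y₂) (σ₂.w⊆v∪⁅added⁆ x∈w₂)
    rhs⊆lhs : v ∪ ⁅ σ₁.added ⁆ ⊆ w₁ ∪ w₂
    rhs⊆lhs {x} x∈v∪y₁ with x∈p∪q⁻ v ⁅ σ₁.added ⁆ x∈v∪y₁
    ... | inj₂ x∈⁅y₁⁆ = x∈p∪q⁺ (inj₁ (subst (_∈ w₁) (sym (x∈⁅y⁆⇒x≡y _ x∈⁅y₁⁆)) σ₁.added∈w))
    ... | inj₁ x∈v with x ≟ σ₁.removed
    ...   | no x≢x₁ = x∈p∪q⁺ (inj₁ (σ₁.∈v⇒∈w x∈v x≢x₁))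
    ...   | yes refl = x∈p∪q⁺ (inj₂ (σ₂.∈v⇒∈w x∈v x₁≢x₂))

  w₁─w₂≡⁅removed₂⁆∪⁅added₁⁆ : σ₁.removed ≢ σ₂.removed → σ₁.added ≢ σ₂.added →
    w₁ ─ w₂ ≡ ⁅ σ₂.removed ⁆ ∪ ⁅ σ₁.added ⁆
  w₁─w₂≡⁅removed₂⁆∪⁅added₁⁆ x₁≢x₂ y₁≢y₂ = ⊆-antisym lhs⊆rhs rhs⊆lhs
    where
    lhs⊆rhs : w₁ ─ w₂ ⊆ ⁅ σ₂.removed ⁆ ∪ ⁅ σ₁.added ⁆
    lhs⊆rhs {x} x∈w₁─w₂ with p─q⊆p w₁ w₂ x∈w₁─w₂ | x∈p─q⇒x∉q w₁ w₂ x∈w₁─w₂ | x ∈? v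
    ... | _ | x∉w₂ | yes x∈v = x∈⁅y⁆∪⁅z⁆⁺ (inj₁ (σ₂.only-removed x∈v x∉w₂))
    ... | x∈w₁ | _ | no x∉v = x∈⁅y⁆∪⁅z⁆⁺ (inj₂ (σ₁.only-added x∈w₁ x∉v))
    rhs⊆lhs : ⁅ σ₂.removed ⁆ ∪ ⁅ σ₁.added ⁆ ⊆ w₁ ─ w₂
    rhs⊆lhs x∈x₂y₁ with x∈⁅y⁆∪⁅z⁆⁻ x∈x₂y₁
    ... | inj₁ refl = x∈p∧x∉q⇒x∈p─q (σ₁.∈v⇒∈w σ₂.removed∈v (x₁≢x₂ ∘ sym)) σ₂.removed∉w
    ... | inj₂ refl = x∈p∧x∉q⇒x∈p─q σ₁.added∈w λ y₁∈w₂ → y₁≢y₂ (σ₂.only-added y₁∈w₂ σ₁.added∉v)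

  v≡w₁∩w₂∪⁅removed₁⁆∪⁅removed₂⁆ : σ₁.added ≢ σ₂.added → v ≡ (w₁ ∩ w₂) ∪ (⁅ σ₁.removed ⁆ ∪ ⁅ σ₂.removed ⁆)
  v≡w₁∩w₂∪⁅removed₁⁆∪⁅removed₂⁆ y₁≢y₂ = ⊆-antisym lhs⊆rhs rhs⊆lhs
    where
    lhs⊆rhs : v ⊆ (w₁ ∩ w₂) ∪ (⁅ σ₁.removed ⁆ ∪ ⁅ σ₂.removed ⁆)
    lhs⊆rhs {x} x∈v with x ≟ σ₁.removed | x ≟ σ₂.removed
    ... | yes x≡x₁ | _ = x∈p∪q⁺ (inj₂ (x∈⁅y⁆∪⁅z⁆⁺ (inj₁ x≡x₁)))
    ... | no _ | yes x≡x₂ = x∈p∪q⁺ (inj₂ (x∈⁅y⁆∪⁅z⁆⁺ (inj₂ x≡x₂)))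
    ... | no x≢x₁ | no x≢x₂ = x∈p∪q⁺ (inj₁ (x∈p∩q⁺ (σ₁.∈v⇒∈w x∈v x≢x₁ , σ₂.∈v⇒∈w x∈v x≢x₂)))
    rhs⊆lhs : (w₁ ∩ w₂) ∪ (⁅ σ₁.removed ⁆ ∪ ⁅ σ₂.removed ⁆) ⊆ v
    rhs⊆lhs {x} x∈rhs with x∈p∪q⁻ (w₁ ∩ w₂) _ x∈rhs
    ... | inj₂ x∈x₁x₂ with x∈⁅y⁆∪⁅z⁆⁻ x∈x₁x₂
    ...   | inj₁ refl = σ₁.removed∈v
    ...   | inj₂ refl = σ₂.removed∈v
    rhs⊆lhs {x} x∈rhs | inj₁ x∈w₁∩w₂ with x∈w₁ , x∈w₂ ← x∈p∩q⁻ w₁ w₂ x∈w₁∩w₂ | x ∈? v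
    ... | yes x∈v = x∈v
    ... | no x∉v = contradiction (trans (sym (σ₁.only-added x∈w₁ x∉v)) (σ₂.only-added x∈w₂ x∉v)) y₁≢y₂

  ∃pick≡⁅removed₂⁆ : σ₁.removed ≢ σ₂.removed → σ₁.added ≢ σ₂.added → ∃ λ c → pick c (w₁ ─ w₂) ≡ ⁅ σ₂.removed ⁆
  ∃pick≡⁅removed₂⁆ x₁≢x₂ y₁≢y₂ = ∣p∣≡2⇒pick≡⁅x⁆
    (trans (cong ∣_∣ w₁─w₂≡x₂y₁) (x≢y⇒∣⁅x⁆∪⁅y⁆∣≡2 λ x₂≡y₁ → σ₁.added∉v (subst (_∈ v) x₂≡y₁ σ₂.removed∈v)))
    (subst (_ ∈_) (sym w₁─w₂≡x₂y₁) (x∈⁅y⁆∪⁅z⁆⁺ (inj₁ refl)))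
    where
    w₁─w₂≡x₂y₁ : w₁ ─ w₂ ≡ ⁅ σ₂.removed ⁆ ∪ ⁅ σ₁.added ⁆
    w₁─w₂≡x₂y₁ = w₁─w₂≡⁅removed₂⁆∪⁅added₁⁆ x₁≢x₂ y₁≢y₂

commonNeighbour : Bool → Bool → Subset m → Subset m → Subset m
commonNeighbour b c w₁ w₂ = (w₁ ∩ w₂) ∪ (pick b (w₂ ─ w₁) ∪ pick c (w₁ ─ w₂))

v≡commonNeighbour : ∀ {v w₁ w₂ : Subset m} (σ₁ : Swap v w₁) (σ₂ : Swap v w₂) →
  Swap.removed σ₁ ≢ Swap.removed σ₂ → Swap.added σ₁ ≢ Swap.added σ₂ →
  ∃₂ λ b c → v ≡ commonNeighbour b c w₁ w₂
v≡commonNeighbour σ₁ σ₂ x₁≢x₂ y₁≢y₂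
  with b , pick≡⁅x₁⁆ ← ∃pick≡⁅removed₂⁆ σ₂ σ₁ (x₁≢x₂ ∘ sym) (y₁≢y₂ ∘ sym)
     | c , pick≡⁅x₂⁆ ← ∃pick≡⁅removed₂⁆ σ₁ σ₂ x₁≢x₂ y₁≢y₂
  = b , c , trans (v≡w₁∩w₂∪⁅removed₁⁆∪⁅removed₂⁆ σ₁ σ₂ y₁≢y₂)
                  (cong₂ (λ p q → _ ∪ (p ∪ q)) (sym pick≡⁅x₁⁆) (sym pick≡⁅x₂⁆))

-- Classification of traces

agreeing-pairs⇒constant : {A B C : Set} {f : A → B} {g : A → C} → DecidableEquality B →
  (∀ s t → f s ≡ f t ⊎ g s ≡ g t) → ∀ {i j} → f i ≡ f j → g i ≢ g j → ∀ t → f t ≡ f i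
agreeing-pairs⇒constant {f = f} _≟ᴮ_ agree {i} {j} fi≡fj gi≢gj t with f t ≟ᴮ f i
... | yes ft≡fi = ft≡fi
... | no ft≢fi with agree t i | agree t j
...   | inj₁ ft≡fi | _ = contradiction ft≡fi ft≢fi
...   | inj₂ _ | inj₁ ft≡fj = contradiction (trans ft≡fj (sym fi≡fj)) ft≢fi
...   | inj₂ gt≡gi | inj₂ gt≡gj = contradiction (trans (sym gt≡gi) gt≡gj) gi≢gj

any-Σ? : {N : Fin n → Set} {P : Σ (Fin n) N → Set} →
  Decidable N → (∀ {l} → Nullary.Irrelevant (N l)) → Decidable P → Dec (∃ P)
any-Σ? {N = N} {P} N? N-irrelevant P? =
  map′ (λ (l , p , Pu) → (l , p) , Pu) (λ ((l , p) , Pu) → l , p , Pu) (Fin.any? P-at?)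
  where
  P-at? : ∀ l → Dec (Σ (N l) λ p → P (l , p))
  P-at? l with N? l
  ... | no ¬p = no (¬p ∘ proj₁)
  ... | yes p = map′ (p ,_) (λ (p′ , Pu) → subst (λ p → P (l , p)) (N-irrelevant p′ p) Pu) (P? (l , p))

data Shape : Set where
  single : Shape
  between : Bool → Bool → Shape
  star top : Bool → Shape

shapes : List Shape
shapes = single ∷ between false false ∷ between false true ∷ between true false ∷ between true true ∷
         star false ∷ star true ∷ top false ∷ top true ∷ []

∈-shapes : ∀ σ → σ List.∈ shapes
∈-shapes single = here refl
∈-shapes (between false false) = there (here refl)
∈-shapes (between false true) = there (there (here refl))
∈-shapes (between true false) = there (there (there (here refl)))
∈-shapes (between true true) = there (there (there (there (here refl))))
∈-shapes (star false) = there (there (there (there (there (here refl)))))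
∈-shapes (star true) = there (there (there (there (there (there (here refl))))))
∈-shapes (top false) = there (there (there (there (there (there (there (here refl)))))))
∈-shapes (top true) = there (there (there (there (there (there (there (there (here refl))))))))

module Candidates {m n : ℕ} (k : ℕ) (a : Fin n → Subset m) where

  -- In the `true` variants a i is v itself, which passes the filter but is not adjacent to v.
  candidate : Fin n → Fin n → Shape → Subset n
  candidate i j single = ⁅ i ⁆
  candidate i j (between b c) = trace k a (commonNeighbour b c (a i) (a j))
  candidate i j (star false) = subsetOf λ l → a i ∩ a j ⊆? a l
  candidate i j (star true) = subsetOf λ l → (a i ∩ a j ⊆? a l) ×-dec ¬? (l ≟ i)
  candidate i j (top false) = subsetOf λ l → a l ⊆? a i ∪ a j
  candidate i j (top true) = subsetOf λ l → (a l ⊆? a i ∪ a j) ×-dec ¬? (l ≟ i)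

  candidates : List (Subset n)
  candidates =
    ⊥ ∷ cartesianProductWith (λ (i , j) → candidate i j) (cartesianProduct (allFin n) (allFin n)) shapes

  ∈-candidates : ∀ {T} i j σ → T ≡ candidate i j σ → T List.∈ candidates
  ∈-candidates i j σ refl = there (∈-cartesianProductWith⁺ (λ (i , j) → candidate i j)
    (∈-cartesianProduct⁺ (∈-allFin i) (∈-allFin j)) (∈-shapes σ))

  length-candidates : length candidates ≡ suc (n * n * 9)
  length-candidates = cong suc (begin
    length (cartesianProductWith _ (cartesianProduct (allFin n) (allFin n)) shapes)
      ≡⟨ length-cartesianProductWith _ (cartesianProduct (allFin n) (allFin n)) shapes ⟩
    length (cartesianProduct (allFin n) (allFin n)) * 9
      ≡⟨ cong (_* 9) (length-cartesianProductWith _,_ (allFin n) (allFin n)) ⟩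
    length (allFin n) * length (allFin n) * 9
      ≡⟨ cong (λ l → l * l * 9) (length-tabulate {n = n} λ i → i) ⟩
    n * n * 9 ∎)
    where open ≡-Reasoning

  module Classification (a-size : ∀ i → ∣ a i ∣ ≡ k) (a-injective : ∀ {i j} → a i ≡ a j → i ≡ j)
                        (v : Subset m) (v-size : ∣ v ∣ ≡ k) where

    Adjacent? : ∀ l → Dec (Adjacent k v (a l))
    Adjacent? l = suc ∣ v ∩ a l ∣ ℕ.≟ k

    trace≡subsetOf : {P : Fin n → Set} (P? : Decidable P) →
      (∀ l → Adjacent k v (a l) ⇔ P l) → trace k a v ≡ subsetOf P?
    trace≡subsetOf = subsetOf-cong Adjacent?

    trace≡ : {p : Subset n} → (∀ l → Adjacent k v (a l) ⇔ l ∈ p) → trace k a v ≡ p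
    trace≡ = subsetOf≡ Adjacent?

    Neighbour : Set
    Neighbour = Σ (Fin n) λ l → Adjacent k v (a l)

    swapOf : ((l , _) : Neighbour) → Swap v (a l)
    swapOf (l , v~l) = Adjacent⇒Swap v-size (a-size l) v~l

    removed added : Neighbour → Fin m
    removed = Swap.removed ∘ swapOf
    added = Swap.added ∘ swapOf

    module _ {Q : Subset m → Set} (Q? : Decidable Q)
             (Adjacent⇔Q : ∀ l → Adjacent k v (a l) ⇔ (Q (a l) × a l ≢ v)) where

      trace≡filter : (∀ r → a r ≢ v) → trace k a v ≡ subsetOf (Q? ∘ a)
      trace≡filter v∉a = trace≡subsetOf (Q? ∘ a) λ l →
        mk⇔ (proj₁ ∘ Adjacent⇔Q l .to) λ Qal → Adjacent⇔Q l .from (Qal , v∉a l)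
        where open Equivalence

      trace≡filter-except : ∀ {r} → a r ≡ v → trace k a v ≡ subsetOf (λ l → Q? (a l) ×-dec ¬? (l ≟ r))
      trace≡filter-except {r} ar≡v = trace≡subsetOf (λ l → Q? (a l) ×-dec ¬? (l ≟ r)) λ l → mk⇔
        (λ v~l → let Qal , al≢v = Adjacent⇔Q l .to v~l in Qal , λ { refl → al≢v ar≡v })
        (λ (Qal , l≢r) → Adjacent⇔Q l .from (Qal , λ al≡v → l≢r (a-injective (trans al≡v (sym ar≡v)))))
        where open Equivalence

    Distinguished : Neighbour → Neighbour → Set
    Distinguished u₁ u₂ = removed u₁ ≢ removed u₂ × added u₁ ≢ added u₂

    distinguished? : Dec (∃₂ Distinguished)
    distinguished? = any-Σ? Adjacent? ≡-irrelevant λ u₁ → any-Σ? Adjacent? ≡-irrelevant λ u₂ →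
      ¬? (removed u₁ ≟ removed u₂) ×-dec ¬? (added u₁ ≟ added u₂)

    ¬distinguished⇒agree : ¬ ∃₂ Distinguished → ∀ u₁ u₂ → removed u₁ ≡ removed u₂ ⊎ added u₁ ≡ added u₂
    ¬distinguished⇒agree ¬dist u₁ u₂ with removed u₁ ≟ removed u₂ | added u₁ ≟ added u₂
    ... | yes x₁≡x₂ | _ = inj₁ x₁≡x₂
    ... | no _ | yes y₁≡y₂ = inj₂ y₁≡y₂
    ... | no x₁≢x₂ | no y₁≢y₂ = contradiction (u₁ , u₂ , x₁≢x₂ , y₁≢y₂) ¬dist

    same-removed⇒different-added : ∀ (u₁ u₂ : Neighbour) → proj₁ u₁ ≢ proj₁ u₂ →
      removed u₁ ≡ removed u₂ → added u₁ ≢ added u₂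
    same-removed⇒different-added u₁ u₂ l₁≢l₂ x₁≡x₂ y₁≡y₂ = l₁≢l₂ (a-injective (⊆-antisym
      (same-swap⇒⊆ (swapOf u₁) (swapOf u₂) x₁≡x₂ y₁≡y₂)
      (same-swap⇒⊆ (swapOf u₂) (swapOf u₁) (sym x₁≡x₂) (sym y₁≡y₂))))

    between-case : ∀ u₁ u₂ → Distinguished u₁ u₂ → trace k a v List.∈ candidates
    between-case u₁@(s , _) u₂@(t , _) (x₁≢x₂ , y₁≢y₂)
      with b , c , v≡ ← v≡commonNeighbour (swapOf u₁) (swapOf u₂) x₁≢x₂ y₁≢y₂ =
      ∈-candidates s t (between b c) (cong (trace k a) v≡)

    Adjacent⇔v-x⊆ : ∀ {x} → (∀ u → removed u ≡ x) → ∀ l → Adjacent k v (a l) ⇔ (v - x ⊆ a l × a l ≢ v)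
    Adjacent⇔v-x⊆ {x} removed≡x l = mk⇔ to from
      where
      to : Adjacent k v (a l) → v - x ⊆ a l × a l ≢ v
      to v~l = subst (λ x → v - x ⊆ a l) (removed≡x (l , v~l)) (Swap.v-removed⊆w (swapOf (l , v~l)))
             , Adjacent⇒≢ v-size v~l
      from : v - x ⊆ a l × a l ≢ v → Adjacent k v (a l)
      from (v-x⊆al , al≢v) = v-x⊆w⇒Adjacent v-size (a-size l) x v-x⊆al al≢v

    Adjacent⇔⊆v∪⁅y⁆ : ∀ {y} → (∀ u → added u ≡ y) → ∀ l → Adjacent k v (a l) ⇔ (a l ⊆ v ∪ ⁅ y ⁆ × a l ≢ v)
    Adjacent⇔⊆v∪⁅y⁆ {y} added≡y l = mk⇔ to from
      where
      to : Adjacent k v (a l) → a l ⊆ v ∪ ⁅ y ⁆ × a l ≢ v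
      to v~l = subst (λ y → a l ⊆ v ∪ ⁅ y ⁆) (added≡y (l , v~l)) (Swap.w⊆v∪⁅added⁆ (swapOf (l , v~l)))
             , Adjacent⇒≢ v-size v~l
      from : a l ⊆ v ∪ ⁅ y ⁆ × a l ≢ v → Adjacent k v (a l)
      from (al⊆v∪y , al≢v) = w⊆v∪⁅y⁆⇒Adjacent v-size (a-size l) y al⊆v∪y al≢v

    v∈a? : Dec (∃ λ r → a r ≡ v)
    v∈a? = Fin.any? λ r → ≡-dec Bool._≟_ (a r) v

    star-case : ∀ u₁ u₂ → removed u₁ ≡ removed u₂ → added u₁ ≢ added u₂ → (∀ u → removed u ≡ removed u₁) →
      trace k a v List.∈ candidates
    star-case u₁@(i , _) u₂@(j , _) x₁≡x₂ y₁≢y₂ removed≡x₁ with v∈a?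
    ... | no v∉a = ∈-candidates i j (star false) (trans
      (trace≡filter (v - removed u₁ ⊆?_) (Adjacent⇔v-x⊆ removed≡x₁) λ r ar≡v → v∉a (r , ar≡v))
      (cong (λ I → subsetOf λ l → I ⊆? a l) (sym (w₁∩w₂≡v-removed (swapOf u₁) (swapOf u₂) x₁≡x₂ y₁≢y₂))))
    ... | yes (r , ar≡v) = ∈-candidates r i (star true) (trans
      (trace≡filter-except (v - removed u₁ ⊆?_) (Adjacent⇔v-x⊆ removed≡x₁) ar≡v)
      (cong (λ I → subsetOf λ l → (I ⊆? a l) ×-dec ¬? (l ≟ r))
            (sym (trans (cong (_∩ a i) ar≡v) (v∩w≡v-removed (swapOf u₁))))))

    top-case : ∀ u₁ u₂ → added u₁ ≡ added u₂ → removed u₁ ≢ removed u₂ → (∀ u → added u ≡ added u₁) →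
      trace k a v List.∈ candidates
    top-case u₁@(i , _) u₂@(j , _) y₁≡y₂ x₁≢x₂ added≡y₁ with v∈a?
    ... | no v∉a = ∈-candidates i j (top false) (trans
      (trace≡filter (_⊆? v ∪ ⁅ added u₁ ⁆) (Adjacent⇔⊆v∪⁅y⁆ added≡y₁) λ r ar≡v → v∉a (r , ar≡v))
      (cong (λ W → subsetOf λ l → a l ⊆? W) (sym (w₁∪w₂≡v∪⁅added⁆ (swapOf u₁) (swapOf u₂) y₁≡y₂ x₁≢x₂))))
    ... | yes (r , ar≡v) = ∈-candidates r i (top true) (trans
      (trace≡filter-except (_⊆? v ∪ ⁅ added u₁ ⁆) (Adjacent⇔⊆v∪⁅y⁆ added≡y₁) ar≡v)
      (cong (λ W → subsetOf λ l → (a l ⊆? W) ×-dec ¬? (l ≟ r))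
            (sym (trans (cong (_∪ a i) ar≡v) (v∪w≡v∪⁅added⁆ (swapOf u₁))))))

    agreeing-case : (∀ u₁ u₂ → removed u₁ ≡ removed u₂ ⊎ added u₁ ≡ added u₂) →
      ∀ u₁ u₂ → proj₁ u₁ ≢ proj₁ u₂ → trace k a v List.∈ candidates
    agreeing-case agree u₁ u₂ l₁≢l₂ with agree u₁ u₂
    ... | inj₁ x₁≡x₂ = star-case u₁ u₂ x₁≡x₂ y₁≢y₂ (agreeing-pairs⇒constant _≟_ agree x₁≡x₂ y₁≢y₂)
      where
      y₁≢y₂ : added u₁ ≢ added u₂
      y₁≢y₂ = same-removed⇒different-added u₁ u₂ l₁≢l₂ x₁≡x₂
    ... | inj₂ y₁≡y₂ =
      top-case u₁ u₂ y₁≡y₂ x₁≢x₂ (agreeing-pairs⇒constant _≟_ (λ s t → swap (agree s t)) y₁≡y₂ x₁≢x₂)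
      where
      x₁≢x₂ : removed u₁ ≢ removed u₂
      x₁≢x₂ x₁≡x₂ = same-removed⇒different-added u₁ u₂ l₁≢l₂ x₁≡x₂ y₁≡y₂

    trace∈candidates : trace k a v List.∈ candidates
    trace∈candidates with Fin.any? Adjacent?
    ... | no no-neighbour =
      here (trace≡ λ l → mk⇔ (λ v~l → contradiction (l , v~l) no-neighbour) λ l∈⊥ → contradiction l∈⊥ ∉⊥)
    ... | yes (i , v~i) with Fin.any? (λ l → ¬? (l ≟ i) ×-dec Adjacent? l)
    ...   | no only-i = ∈-candidates i i single (trace≡ λ l → mk⇔
      (λ v~l → subst (_∈ ⁅ i ⁆) (sym (neighbour≡i l v~l)) (x∈⁅x⁆ i))
      (λ l∈⁅i⁆ → subst (Adjacent k v ∘ a) (sym (x∈⁅y⁆⇒x≡y i l∈⁅i⁆)) v~i))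
      where
      neighbour≡i : ∀ l → Adjacent k v (a l) → l ≡ i
      neighbour≡i l v~l with l ≟ i
      ... | yes l≡i = l≡i
      ... | no l≢i = contradiction (l , l≢i , v~l) only-i
    ...   | yes (j , j≢i , v~j) with distinguished?
    ...     | yes (s , t , s≁t) = between-case s t s≁t
    ...     | no ¬dist = agreeing-case (¬distinguished⇒agree ¬dist) (i , v~i) (j , v~j) (j≢i ∘ sym)

traceCount≤ : ∀ {m k n} (a : Fin n → Subset m) → IsVertexSet m k n a → traceCount m k a ≤ suc (n * n * 9)
traceCount≤ {m} {k} a (a-size , a-injective) =
  ≤-trans (length-deduplicate-≤ (≡-dec Bool._≟_) traces⊆candidates) (≤-reflexive length-candidates)
  where
  open Candidates k a
  traces⊆candidates : traces m k a List.⊆ candidates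
  traces⊆candidates T∈traces with v , v∈J , refl ← ∈-map⁻ (trace k a) T∈traces =
    Classification.trace∈candidates a-size a-injective v
      (proj₂ (∈-filter⁻ (λ s → ∣ s ∣ ℕ.≟ k) {xs = allSubsets m} v∈J))

-- A family with quadratically many traces

↑ˡ≢↑ʳ : ∀ {m n} (i : Fin m) (j : Fin n) → i ↑ˡ n ≢ m ↑ʳ j
↑ˡ≢↑ʳ zero j ()
↑ˡ≢↑ʳ (suc i) j eq = ↑ˡ≢↑ʳ i j (Fin.suc-injective eq)

module PairFamily (n : ℕ) where

  L R : Fin n → Fin (n + n)
  L l = l ↑ˡ n
  R l = n ↑ʳ l

  L-injective : ∀ {p q} → L p ≡ L q → p ≡ q
  L-injective = Fin.↑ˡ-injective n _ _

  a : Fin n → Subset (n + n)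
  a l = ⁅ L l ⁆ ∪ ⁅ R l ⁆

  a-isVertexSet : IsVertexSet (n + n) 2 n a
  a-isVertexSet = (λ l → x≢y⇒∣⁅x⁆∪⁅y⁆∣≡2 (↑ˡ≢↑ʳ l l)) , a-injective
    where
    a-injective : ∀ {l l′} → a l ≡ a l′ → l ≡ l′
    a-injective {l} {l′} al≡al′ with x∈⁅y⁆∪⁅z⁆⁻ (subst (L l ∈_) al≡al′ (x∈⁅y⁆∪⁅z⁆⁺ (inj₁ refl)))
    ... | inj₁ Ll≡Ll′ = L-injective Ll≡Ll′
    ... | inj₂ Ll≡Rl′ = contradiction Ll≡Rl′ (↑ˡ≢↑ʳ l l′)

  trace-⁅Lp⁆∪⁅Lq⁆ : ∀ p q → trace 2 a (⁅ L p ⁆ ∪ ⁅ L q ⁆) ≡ ⁅ p ⁆ ∪ ⁅ q ⁆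
  trace-⁅Lp⁆∪⁅Lq⁆ p q = subsetOf≡ (λ l → suc ∣ v ∩ a l ∣ ℕ.≟ 2) λ l → mk⇔ (to l) (from l)
    where
    v : Subset (n + n)
    v = ⁅ L p ⁆ ∪ ⁅ L q ⁆
    v∩al⊆⁅Ll⁆ : ∀ l → v ∩ a l ⊆ ⁅ L l ⁆
    v∩al⊆⁅Ll⁆ l {e} e∈v∩al with e∈v , e∈al ← x∈p∩q⁻ v (a l) e∈v∩al | x∈⁅y⁆∪⁅z⁆⁻ e∈v | x∈⁅y⁆∪⁅z⁆⁻ e∈al
    ... | _ | inj₁ refl = x∈⁅x⁆ (L l)
    ... | inj₁ refl | inj₂ Lp≡Rl = contradiction Lp≡Rl (↑ˡ≢↑ʳ p l)
    ... | inj₂ refl | inj₂ Lq≡Rl = contradiction Lq≡Rl (↑ˡ≢↑ʳ q l)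
    to : ∀ l → suc ∣ v ∩ a l ∣ ≡ 2 → l ∈ ⁅ p ⁆ ∪ ⁅ q ⁆
    to l v~l = x∈⁅y⁆∪⁅z⁆⁺ (Sum.map L-injective L-injective (x∈⁅y⁆∪⁅z⁆⁻ (proj₁ (x∈p∩q⁻ v (a l) Ll∈v∩al))))
      where
      Ll∈v∩al : L l ∈ v ∩ a l
      Ll∈v∩al = Equivalence.to (∣p∣≡1⇔x∈p (v∩al⊆⁅Ll⁆ l)) (suc-injective v~l)
    from : ∀ l → l ∈ ⁅ p ⁆ ∪ ⁅ q ⁆ → suc ∣ v ∩ a l ∣ ≡ 2
    from l l∈pq = cong suc (Equivalence.from (∣p∣≡1⇔x∈p (v∩al⊆⁅Ll⁆ l))
      (x∈p∩q⁺ (x∈⁅y⁆∪⁅z⁆⁺ (Sum.map (cong L) (cong L) (x∈⁅y⁆∪⁅z⁆⁻ l∈pq)) , x∈⁅y⁆∪⁅z⁆⁺ (inj₁ refl))))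

h*h≤traceCount : ∀ h → h * h ≤ traceCount ((h + h) + (h + h)) 2 (PairFamily.a (h + h))
h*h≤traceCount h = subst (_≤ traceCount ((h + h) + (h + h)) 2 a) length-pairs
  (length-deduplicate-≥ (≡-dec Bool._≟_)
    (cartesianProductWith⁺ pair pair-injective (allFin⁺ h) (allFin⁺ h)) pairs⊆traces)
  where
  open PairFamily (h + h)
  pair : Fin h → Fin h → Subset (h + h)
  pair i j = ⁅ i ↑ˡ h ⁆ ∪ ⁅ h ↑ʳ j ⁆
  pair-injective : ∀ {i i′ j j′} → pair i j ≡ pair i′ j′ → i ≡ i′ × j ≡ j′
  pair-injective {i} {i′} {j} {j′} eq with x∈⁅y⁆∪⁅z⁆⁻ (subst (i ↑ˡ h ∈_) eq (x∈⁅y⁆∪⁅z⁆⁺ (inj₁ refl)))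
                                       | x∈⁅y⁆∪⁅z⁆⁻ (subst (h ↑ʳ j ∈_) eq (x∈⁅y⁆∪⁅z⁆⁺ (inj₂ refl)))
  ... | inj₂ i≡j′ | _ = contradiction i≡j′ (↑ˡ≢↑ʳ i j′)
  ... | _ | inj₁ j≡i′ = contradiction (sym j≡i′) (↑ˡ≢↑ʳ i′ j)
  ... | inj₁ i≡i′ | inj₂ j≡j′ = Fin.↑ˡ-injective h i i′ i≡i′ , Fin.↑ʳ-injective h j j′ j≡j′
  pairs : List (Subset (h + h))
  pairs = cartesianProductWith pair (allFin h) (allFin h)
  length-pairs : length pairs ≡ h * h
  length-pairs = trans (length-cartesianProductWith pair (allFin h) (allFin h))
                       (cong (λ l → l * l) (length-tabulate {n = h} λ i → i))
  pairs⊆traces : pairs List.⊆ traces ((h + h) + (h + h)) 2 a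
  pairs⊆traces T∈pairs with i , j , _ , _ , refl ← ∈-cartesianProductWith⁻ pair (allFin h) (allFin h) T∈pairs =
    subst (List._∈ traces _ 2 a) (trace-⁅Lp⁆∪⁅Lq⁆ (i ↑ˡ h) (h ↑ʳ j))
      (∈-map⁺ (trace 2 a) (∈-filter⁺ (λ s → ∣ s ∣ ℕ.≟ 2) (∈-allSubsets (⁅ L (i ↑ˡ h) ⁆ ∪ ⁅ L (h ↑ʳ j) ⁆))
        (x≢y⇒∣⁅x⁆∪⁅y⁆∣≡2 (↑ˡ≢↑ʳ i j ∘ L-injective))))

-- VC-density

^-distribʳ-* : ∀ m n o → (m * n) ^ o ≡ m ^ o * n ^ o
^-distribʳ-* m n zero = refl
^-distribʳ-* m n (suc o) = trans (cong (m * n *_) (^-distribʳ-* m n o)) (interchange m n (m ^ o) (n ^ o))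
  where
  interchange : ∀ a b c d → a * b * (c * d) ≡ a * c * (b * d)
  interchange = solve-∀

[m*m]^n≡m^[n+n] : ∀ m n → (m * m) ^ n ≡ m ^ (n + n)
[m*m]^n≡m^[n+n] m n = trans (^-distribʳ-* m m n) (sym (^-distribˡ-+-* m n n))

2^n≤traceCount : ∀ {m k n} (a : Fin n → Subset m) → Shattered m k n a → 2 ^ n ≤ traceCount m k a
2^n≤traceCount {m} {k} {n} a shattered = subst (_≤ traceCount m k a) (length-allSubsets n)
  (length-deduplicate-≥ (≡-dec Bool._≟_) (allSubsets-unique n) λ {t} _ → shattered t)

quadratic<exponential : ∀ j → suc ((10 + j) * (10 + j) * 9) < 2 ^ (10 + j)
quadratic<exponential zero = toWitness {a? = 902 ≤? 1024} tt
quadratic<exponential (suc j) = begin-strict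
  suc ((11 + j) * (11 + j) * 9)                                 <⟨ m<m+n _ (s≤s z≤n) ⟩
  suc ((11 + j) * (11 + j) * 9) + suc (9 * (79 + 18 * j + j * j)) ≡⟨ identity j ⟨
  2 * suc ((10 + j) * (10 + j) * 9)                               ≤⟨ *-monoʳ-≤ 2 (<⇒≤ (quadratic<exponential j)) ⟩
  2 * 2 ^ (10 + j)                                                ∎
  where
  open ≤-Reasoning
  identity : ∀ j →
    2 * suc ((10 + j) * (10 + j) * 9) ≡ suc ((11 + j) * (11 + j) * 9) + suc (9 * (79 + 18 * j + j * j))
  identity = solve-∀

2^n≤1+9n²⇒n≤9 : ∀ n → 2 ^ n ≤ suc (n * n * 9) → n ≤ 9
2^n≤1+9n²⇒n≤9 n 2^n≤ with n ≤? 9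
... | yes n≤9 = n≤9
... | no n≰9 with j , refl ← m≤n⇒∃[o]m+o≡n (≰⇒> n≰9) = contradiction 2^n≤ (<⇒≱ (quadratic<exponential j))

finiteVC : FiniteVC
finiteVC = 9 , λ m k n _ a a-isVertexSet shattered →
  2^n≤1+9n²⇒n≤9 n (≤-trans (2^n≤traceCount a shattered) (traceCount≤ a a-isVertexSet))

upper-bound : ∀ p q → 0 < q → 2 * q < p → ShatterFnBigO p q
upper-bound p q _ 2q<p = 10 ^ q , 1 , bound
  where
  q+q≤p : q + q ≤ p
  q+q≤p = subst (_≤ p) (cong (q +_) (+-identityʳ q)) (<⇒≤ 2q<p)
  bound : ∀ n → 1 ≤ n → ∀ m k → k ≤ m → (a : Fin n → Subset m) → IsVertexSet m k n a →
    traceCount m k a ^ q ≤ 10 ^ q * n ^ p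
  bound n@(suc j) _ m k _ a a-isVertexSet = begin
    traceCount m k a ^ q   ≤⟨ ^-monoˡ-≤ q (≤-trans (traceCount≤ a a-isVertexSet) quadratic) ⟩
    (10 * (n * n)) ^ q     ≡⟨ ^-distribʳ-* 10 (n * n) q ⟩
    10 ^ q * (n * n) ^ q   ≡⟨ cong (10 ^ q *_) ([m*m]^n≡m^[n+n] n q) ⟩
    10 ^ q * n ^ (q + q)   ≤⟨ *-monoʳ-≤ (10 ^ q) (^-monoʳ-≤ n q+q≤p) ⟩
    10 ^ q * n ^ p         ∎
    where
    open ≤-Reasoning
    quadratic : suc (n * n * 9) ≤ 10 * (n * n)
    quadratic = subst (suc (n * n * 9) ≤_) (identity j) (m≤m+n _ _)
      where
      identity : ∀ j → suc (suc j * suc j * 9) + (j * j + 2 * j) ≡ 10 * (suc j * suc j)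
      identity = solve-∀

lower-bound : ∀ p q → 0 < q → 0 < p → p < 2 * q → ¬ ShatterFnBigO p q
lower-bound p q _ _ p<2q (C , N , bound) = contradiction h≤C*2^p (<⇒≱ (s≤s (m≤m+n _ N)))
  where
  h : ℕ
  h = suc (C * 2 ^ p + N)
  open PairFamily (h + h)
  N≤2h : N ≤ h + h
  N≤2h = ≤-trans (≤-trans (m≤n+m N _) (n≤1+n _)) (m≤m+n h h)
  2≤4h : 2 ≤ (h + h) + (h + h)
  2≤4h = ≤-trans (+-mono-≤ {1} {h} {1} {h} (s≤s z≤n) (s≤s z≤n)) (m≤m+n (h + h) (h + h))
  h*h^p≤C*2^p*h^p : h * h ^ p ≤ C * 2 ^ p * h ^ p
  h*h^p≤C*2^p*h^p = begin
    h ^ suc p                                ≤⟨ ^-monoʳ-≤ h (subst (suc p ≤_) (cong (q +_) (+-identityʳ q)) p<2q) ⟩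
    h ^ (q + q)                              ≡⟨ [m*m]^n≡m^[n+n] h q ⟨
    (h * h) ^ q                              ≤⟨ ^-monoˡ-≤ q (h*h≤traceCount h) ⟩
    traceCount ((h + h) + (h + h)) 2 a ^ q   ≤⟨ bound (h + h) N≤2h _ 2 2≤4h a a-isVertexSet ⟩
    C * (h + h) ^ p                          ≡⟨ cong (λ x → C * x ^ p) (cong (h +_) (+-identityʳ h)) ⟨
    C * (2 * h) ^ p                          ≡⟨ cong (C *_) (^-distribʳ-* 2 h p) ⟩
    C * (2 ^ p * h ^ p)                      ≡⟨ *-assoc C (2 ^ p) (h ^ p) ⟨
    C * 2 ^ p * h ^ p                        ∎
    where open ≤-Reasoning
  h≤C*2^p : h ≤ C * 2 ^ p
  h≤C*2^p = *-cancelʳ-≤ h (C * 2 ^ p) (h ^ p) {{m^n≢0 h p}} h*h^p≤C*2^p*h^p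

mainTheorem3 : VCDensityIsTwo
mainTheorem3 = finiteVC , upper-bound , lower-bound
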